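{- Let $d$ be a squarefree integer, $d\neq 0,1$, let $p>3$ be a prime with $\gcd(p,d)=1$, and let $a,b\in\mathbb{Z}$. Then: (i) $Im\left((a+b\sqrt{d})^p\right)=0$ if and only if $b=0$; (ii) $Re\left((a+b\sqrt{d})^p\right)=0$ if and only if $a=0$.
   Context: For an element $a+b\sqrt{d}$ of $K=\mathbb{Q}(\sqrt{d})$ with $a,b\in\mathbb{Q}$, its "real part" is $Re(a+b\sqrt{d})=a$ and its "imaginary part" is $Im(a+b\sqrt{d})=b$ (these are defined this way for every squarefree $d$, positive or negative). -}

module Defs where

open import Data.Nat using (ℕ; zero; suc)
import Data.Nat as ℕ
open import Data.Nat.Divisibility using (_∣_)
open import Data.Integer using (ℤ; _+_; _*_; ∣_∣; 0ℤ; 1ℤ)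
open import Data.Product using (_×_; _,_; proj₁; proj₂)
open import Relation.Binary.PropositionalEquality using (_≡_)

-- A squarefree integer: no square of a natural number n > 1 divides it.
-- (n = 0 is excluded automatically once d ≠ 0; we require n * n ∣ |d| → n ≡ 1.)
SquareFree : ℤ → Set
SquareFree d = ∀ (n : ℕ) → (n ℕ.* n) ∣ ∣ d ∣ → n ≡ 1

-- Elements a + b√d of ℤ[√d] ⊆ ℚ(√d), represented by the pair (a , b).
QZ : Set
QZ = ℤ × ℤ

Re : QZ → ℤ
Re = proj₁

Im : QZ → ℤ
Im = proj₂

-- multiplication in ℤ[√d]: (a + b√d)(c + e√d) = (ac + d b e) + (ae + bc)√d
mul : ℤ → QZ → QZ → QZ
mul d (a , b) (c , e) = (a * c + d * (b * e)) , (a * e + b * c)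

pow : ℤ → QZ → ℕ → QZ
pow d x zero = 1ℤ , 0ℤ
pow d x (suc n) = mul d x (pow d x n)

module Submission where

open import Defs
open import Data.Nat using (ℕ; _>_)
open import Data.Nat.Primality using (Prime)
open import Data.Nat.GCD using (gcd)
open import Data.Integer using (ℤ; ∣_∣; 0ℤ; 1ℤ)
open import Data.Product using (_×_; _,_)
open import Relation.Binary.PropositionalEquality using (_≡_; _≢_)
open import Function.Bundles using (_⇔_)

open import Data.Nat as ℕ using (zero; suc; _<_; _∸_; s≤s; z≤n)
import Data.Nat.Properties as ℕ
import Data.Nat.Divisibility as ℕ
import Data.Nat.Tactic.RingSolver as ℕ
open import Data.Nat.Combinatorics using (_C_; nCn≡1; nC1≡n; nCk+nC[k+1]≡[n+1]C[k+1])
open import Data.Nat.DivMod using (_%_; _/_; m≡m%n+[m/n]*n; m%n<n)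
open import Data.Nat.Primality using (euclidsLemma; prime⇒irreducible; prime⇒nonTrivial; ¬prime[1])
open import Data.Nat.Coprimality using (Coprime; gcd≡1⇒coprime)
open import Data.Nat.Induction using (<-wellFounded)
open import Data.Integer as ℤ using (+_)
import Data.Integer.Properties as ℤ
open import Data.Integer.Divisibility.Signed
  using (_∣_; module _∣_; divides; ∣⇒∣ᵤ; ∣ᵤ⇒∣; ∣-refl; ∣m+n∣n⇒∣m; ∣m⇒∣m*n)
open import Data.Integer.Tactic.RingSolver using (solve-∀)
open import Data.Fin using (zero; suc; toℕ; fromℕ; inject₁)
open import Data.Fin.Properties using (toℕ-fromℕ; toℕ-inject₁; toℕ<n)
open import Data.Vec.Functional using (Vector)
open import Data.Product using (∃-syntax; ∃₂; proj₁; proj₂)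
open import Data.Sum as Sum using (_⊎_; inj₁; inj₂; [_,_]′)
open import Data.Empty using (⊥-elim)
open import Function using (_∘_; _on_; id; mk⇔; Equivalence)
open import Induction.InfiniteDescent using (Descent; descent∧wf⇒empty)
import Relation.Binary.Construct.On as On
open import Relation.Nullary using (¬_; contradiction)
open import Relation.Nullary.Decidable using (decidable-stable)
open import Relation.Binary.PropositionalEquality
  using (refl; sym; trans; cong; cong₂; subst; isEquivalence; module ≡-Reasoning)
open import Algebra.Bundles using (CommutativeSemiring)

-- Write p = 2m + 1. In the binomial expansion of (a + b√d)^p every middle coefficient is
-- divisible by p, so Im((a + b√d)^p) ≡ b^p d^m (mod p), and a vanishing imaginary part forces
-- p ∣ b because p ∤ d. With b = pb′, the expansion Im((a + b√d)^p) = p a^(p-1) b + b³(…)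
-- then forces p ∣ a, so a + b√d = p(a′ + b′√d) where again Im((a′ + b′√d)^p) = 0 and
-- |b′| < |b|: by infinite descent b = 0. For the real part, (a + b√d)√d = db + a√d and
-- (√d)^p = d^m √d give Re((a + b√d)^p) d^m = Im((db + a√d)^p), which reduces (ii) to (i).

[1+k]*[1+n]C[1+k]≡[1+n]*nCk : ∀ n k → suc k ℕ.* (suc n C suc k) ≡ suc n ℕ.* (n C k)
[1+k]*[1+n]C[1+k]≡[1+n]*nCk zero    zero    = refl
[1+k]*[1+n]C[1+k]≡[1+n]*nCk zero    (suc k) = ℕ.*-zeroʳ (suc (suc k))
[1+k]*[1+n]C[1+k]≡[1+n]*nCk (suc n) zero    =
  trans (ℕ.*-identityˡ _) (trans (nC1≡n (suc (suc n))) (sym (ℕ.*-identityʳ _)))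
[1+k]*[1+n]C[1+k]≡[1+n]*nCk (suc n) (suc k) = begin
  suc (suc k) ℕ.* (suc (suc n) C suc (suc k))
    ≡⟨ cong (suc (suc k) ℕ.*_) (nCk+nC[k+1]≡[n+1]C[k+1] (suc n) (suc k)) ⟨
  suc (suc k) ℕ.* (suc n C suc k ℕ.+ suc n C suc (suc k))
    ≡⟨ regroup k (suc n C suc k) (suc n C suc (suc k)) ⟩
  suc n C suc k ℕ.+ (suc k ℕ.* (suc n C suc k) ℕ.+ suc (suc k) ℕ.* (suc n C suc (suc k)))
    ≡⟨ cong₂ (λ u v → suc n C suc k ℕ.+ (u ℕ.+ v))
             ([1+k]*[1+n]C[1+k]≡[1+n]*nCk n k) ([1+k]*[1+n]C[1+k]≡[1+n]*nCk n (suc k)) ⟩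
  suc n C suc k ℕ.+ (suc n ℕ.* (n C k) ℕ.+ suc n ℕ.* (n C suc k))
    ≡⟨ cong (suc n C suc k ℕ.+_) (ℕ.*-distribˡ-+ (suc n) (n C k) (n C suc k)) ⟨
  suc n C suc k ℕ.+ suc n ℕ.* (n C k ℕ.+ n C suc k)
    ≡⟨ cong (λ u → suc n C suc k ℕ.+ suc n ℕ.* u) (nCk+nC[k+1]≡[n+1]C[k+1] n k) ⟩
  suc (suc n) ℕ.* (suc n C suc k) ∎
  where
  open ≡-Reasoning
  regroup : ∀ k x y → suc (suc k) ℕ.* (x ℕ.+ y) ≡ x ℕ.+ (suc k ℕ.* x ℕ.+ suc (suc k) ℕ.* y)
  regroup = ℕ.solve-∀

prime∣pCk : ∀ {p k} → Prime p → 0 < k → k < p → p ℕ.∣ p C k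
prime∣pCk {k = zero} _ () _
prime∣pCk {suc n} {suc k} p-prime _ k<p
  with euclidsLemma (suc k) (suc n C suc k) p-prime
         (subst (suc n ℕ.∣_) (sym ([1+k]*[1+n]C[1+k]≡[1+n]*nCk n k)) (ℕ.m∣m*n (n C k)))
... | inj₁ p∣1+k = ⊥-elim (ℕ.<⇒≱ k<p (ℕ.∣⇒≤ p∣1+k))
... | inj₂ p∣pCk = p∣pCk

module FreshmansDream {c ℓ} (S : CommutativeSemiring c ℓ) where

  open CommutativeSemiring S
    using (Carrier; _≈_; _+_; _*_; 1#; setoid; semiring; +-cong; +-congˡ; +-congʳ; +-comm; +-assoc;
           *-identityˡ; *-identityʳ)
    renaming (sym to ≈-sym; trans to ≈-trans)
  open import Algebra.Properties.Semiring.Exp semiring using (_^_)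
  open import Algebra.Properties.Semiring.Mult semiring
    renaming (_×_ to _×ₙ_) using (×-congʳ; ×-assocˡ; ×-comm-*; ×-assoc-*; ×-homo-1)
  open import Algebra.Properties.Semiring.Sum semiring
    using (sum; sum-cong-≋; sum-init-last; *-distribˡ-sum)
  open import Algebra.Properties.CommutativeSemiring.Binomial S using (theorem; binomialTerm)
  open import Relation.Binary.Reasoning.Setoid setoid

  MultipleOf : ℕ → Carrier → Set _
  MultipleOf n x = ∃[ z ] x ≈ (n ×ₙ 1#) * z

  sum-multipleOf : ∀ {n k} (t : Vector Carrier k) → (∀ i → MultipleOf n (t i)) → MultipleOf n (sum t)
  sum-multipleOf t t-mult =
    sum (proj₁ ∘ t-mult) ,
    ≈-trans (sum-cong-≋ (proj₂ ∘ t-mult)) (≈-sym (*-distribˡ-sum _ (proj₁ ∘ t-mult)))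

  ×-multipleOf : ∀ {n} m x → n ℕ.∣ m → MultipleOf n (m ×ₙ x)
  ×-multipleOf {n} m x (ℕ.divides q m≡q*n) = q ×ₙ x , (begin
    m ×ₙ x                ≡⟨ cong (_×ₙ x) m≡q*n ⟩
    (q ℕ.* n) ×ₙ x        ≈⟨ ×-assocˡ x q n ⟨
    q ×ₙ (n ×ₙ x)         ≈⟨ ×-congʳ q (×-congʳ n (*-identityˡ x)) ⟨
    q ×ₙ (n ×ₙ (1# * x))  ≈⟨ ×-congʳ q (×-assoc-* n 1# x) ⟨
    q ×ₙ ((n ×ₙ 1#) * x)  ≈⟨ ×-comm-* q (n ×ₙ 1#) x ⟨
    (n ×ₙ 1#) * (q ×ₙ x)  ∎)

  freshmansDream : ∀ {p} → Prime p → ∀ x y → ∃[ z ] (x + y) ^ p ≈ x ^ p + y ^ p + (p ×ₙ 1#) * z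
  freshmansDream {suc n} p-prime x y = z , (begin
    (x + y) ^ p                                ≈⟨ theorem p x y ⟩
    sum term                                   ≈⟨ +-congˡ (sum-init-last middleAndLast) ⟩
    term zero + (sum middle + term (fromℕ p))
      ≈⟨ +-cong first≈y^p (+-cong (proj₂ middle-mult) last≈x^p) ⟩
    y ^ p + ((p ×ₙ 1#) * z + x ^ p)            ≈⟨ +-congˡ (+-comm _ _) ⟩
    y ^ p + (x ^ p + (p ×ₙ 1#) * z)            ≈⟨ +-assoc _ _ _ ⟨
    y ^ p + x ^ p + (p ×ₙ 1#) * z              ≈⟨ +-congʳ (+-comm _ _) ⟩
    x ^ p + y ^ p + (p ×ₙ 1#) * z              ∎)
    where
    p : ℕ
    p = suc n
    term : Vector Carrier (suc p)
    term = binomialTerm x y p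
    middleAndLast : Vector Carrier (suc n)
    middleAndLast i = term (suc i)
    middle : Vector Carrier n
    middle i = term (suc (inject₁ i))
    middle-mult : MultipleOf p (sum middle)
    middle-mult = sum-multipleOf {p} middle λ i →
      ×-multipleOf _ _ (prime∣pCk p-prime (s≤s z≤n)
                                  (s≤s (subst (_< n) (sym (toℕ-inject₁ i)) (toℕ<n i))))
    z : Carrier
    z = proj₁ middle-mult
    first≈y^p : term zero ≈ y ^ p
    first≈y^p = ≈-trans (×-homo-1 _) (*-identityˡ _)
    last≈x^p : term (fromℕ p) ≈ x ^ p
    last≈x^p = lastTerm (toℕ (fromℕ p)) (toℕ-fromℕ p)
      where
      lastTerm : ∀ k → k ≡ p → (p C k) ×ₙ (x ^ k * y ^ (p ∸ k)) ≈ x ^ p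
      lastTerm .p refl = begin
        (p C p) ×ₙ (x ^ p * y ^ (p ∸ p))
          ≡⟨ cong₂ (λ c e → c ×ₙ (x ^ p * y ^ e)) (nCn≡1 p) (ℕ.n∸n≡0 p) ⟩
        1 ×ₙ (x ^ p * 1#)                ≈⟨ ×-homo-1 _ ⟩
        x ^ p * 1#                       ≈⟨ *-identityʳ _ ⟩
        x ^ p                            ∎

-- Imported only here, since FreshmansDream uses these names for the semiring operations.
open import Data.Integer using (_+_; _*_; _^_)

odd-prime : ∀ {p} → Prime p → 2 < p → ∃[ m ] p ≡ suc (m ℕ.* 2)
odd-prime {p} p-prime 2<p with p % 2 | m≡m%n+[m/n]*n p 2 | m%n<n p 2
... | 0           | p≡[p/2]*2   | _ = ⊥-elim ([ (λ ()) , (λ 2≡p → ℕ.<-irrefl 2≡p 2<p) ]′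
                                        (prime⇒irreducible p-prime (ℕ.divides (p / 2) p≡[p/2]*2)))
... | 1           | p≡1+[p/2]*2 | _ = p / 2 , p≡1+[p/2]*2
... | suc (suc _) | _           | s≤s (s≤s ())

prime∧coprime⇒∤ : ∀ {p n} → Prime p → Coprime p n → ¬ (p ℕ.∣ n)
prime∧coprime⇒∤ p-prime coprime p∣n = ¬prime[1] (subst Prime (coprime (ℕ.∣-refl , p∣n)) p-prime)

i*j≢0⇒i≢0 : ∀ {i j} → i * j ≢ 0ℤ → i ≢ 0ℤ
i*j≢0⇒i≢0 {j = j} i*j≢0 i≡0 = i*j≢0 (trans (cong (_* j) i≡0) (ℤ.*-zeroˡ j))

i≢0⇒i*j≡0⇒j≡0 : ∀ {i j} → i ≢ 0ℤ → i * j ≡ 0ℤ → j ≡ 0ℤ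
i≢0⇒i*j≡0⇒j≡0 {i} i≢0 = [ ⊥-elim ∘ i≢0 , id ]′ ∘ ℤ.i*j≡0⇒i≡0∨j≡0 i

x+kt≡0⇒k∣x : ∀ {k x} t → x + k * t ≡ 0ℤ → k ∣ x
x+kt≡0⇒k∣x {k} t x+kt≡0 =
  ∣m+n∣n⇒∣m (subst (k ∣_) (sym x+kt≡0) (divides 0ℤ (sym (ℤ.*-zeroˡ k)))) (∣m⇒∣m*n t ∣-refl)

prime∣*⇒∣⊎∣ : ∀ {p} → Prime p → ∀ i j → + p ∣ i * j → (+ p ∣ i) ⊎ (+ p ∣ j)
prime∣*⇒∣⊎∣ {p} p-prime i j p∣ij =
  Sum.map ∣ᵤ⇒∣ ∣ᵤ⇒∣
    (euclidsLemma ∣ i ∣ ∣ j ∣ p-prime (subst (p ℕ.∣_) (ℤ.abs-* i j) (∣⇒∣ᵤ p∣ij)))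

prime∣^⇒∣ : ∀ {p} → Prime p → ∀ i n → + p ∣ i ^ n → + p ∣ i
prime∣^⇒∣ p-prime i zero    p∣1 =
  ⊥-elim (¬prime[1] (subst Prime (ℕ.∣1⇒≡1 (∣⇒∣ᵤ p∣1)) p-prime))
prime∣^⇒∣ p-prime i (suc n) p∣i^[1+n] =
  [ id , prime∣^⇒∣ p-prime i n ]′ (prime∣*⇒∣⊎∣ p-prime i (i ^ n) p∣i^[1+n])

module ℤ[√d] (d : ℤ) where

  open import Algebra.Definitions (_≡_ {A = QZ})
  open import Algebra.Structures (_≡_ {A = QZ})
  open import Algebra.Structures.Biased (_≡_ {A = QZ})
    using (IsCommutativeMonoidˡ; IsCommutativeSemiringˡ)

  infixl 6 _⊕_
  infixl 7 _⊗_

  _⊕_ : QZ → QZ → QZ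
  (a , b) ⊕ (c , e) = a + c , b + e

  _⊗_ : QZ → QZ → QZ
  _⊗_ = mul d

  0q 1q : QZ
  0q = 0ℤ , 0ℤ
  1q = 1ℤ , 0ℤ

  ⊕-assoc : Associative _⊕_
  ⊕-assoc (a , b) (c , e) (f , g) = cong₂ _,_ (ℤ.+-assoc a c f) (ℤ.+-assoc b e g)

  ⊕-comm : Commutative _⊕_
  ⊕-comm (a , b) (c , e) = cong₂ _,_ (ℤ.+-comm a c) (ℤ.+-comm b e)

  ⊕-identityˡ : LeftIdentity 0q _⊕_
  ⊕-identityˡ (a , b) = cong₂ _,_ (ℤ.+-identityˡ a) (ℤ.+-identityˡ b)

  ⊗-assoc : Associative _⊗_
  ⊗-assoc (a , b) (c , e) (f , g) = cong₂ _,_ (re a b c e f g d) (im a b c e f g d)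
    where
    re : ∀ a b c e f g d → (a * c + d * (b * e)) * f + d * ((a * e + b * c) * g)
                         ≡ a * (c * f + d * (e * g)) + d * (b * (c * g + e * f))
    re = solve-∀
    im : ∀ a b c e f g d → (a * c + d * (b * e)) * g + (a * e + b * c) * f
                         ≡ a * (c * g + e * f) + b * (c * f + d * (e * g))
    im = solve-∀

  ⊗-comm : Commutative _⊗_
  ⊗-comm (a , b) (c , e) = cong₂ _,_ (re a b c e d) (im a b c e)
    where
    re : ∀ a b c e d → a * c + d * (b * e) ≡ c * a + d * (e * b)
    re = solve-∀
    im : ∀ a b c e → a * e + b * c ≡ c * b + e * a
    im = solve-∀

  ⊗-identityˡ : LeftIdentity 1q _⊗_
  ⊗-identityˡ (a , b) = cong₂ _,_ (re a b d) (im a b)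
    where
    re : ∀ a b d → 1ℤ * a + d * (0ℤ * b) ≡ a
    re = solve-∀
    im : ∀ a b → 1ℤ * b + 0ℤ * a ≡ b
    im = solve-∀

  ⊗-distribʳ-⊕ : _⊗_ DistributesOverʳ _⊕_
  ⊗-distribʳ-⊕ (a , b) (c , e) (f , g) = cong₂ _,_ (re a b c e f g d) (im a b c e f g)
    where
    re : ∀ a b c e f g d → (c + f) * a + d * ((e + g) * b)
                         ≡ (c * a + d * (e * b)) + (f * a + d * (g * b))
    re = solve-∀
    im : ∀ a b c e f g → (c + f) * b + (e + g) * a ≡ (c * b + e * a) + (f * b + g * a)
    im = solve-∀

  ⊗-zeroˡ : LeftZero 0q _⊗_
  ⊗-zeroˡ (a , b) = cong₂ _,_ (re a b d) (im a b)
    where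
    re : ∀ a b d → 0ℤ * a + d * (0ℤ * b) ≡ 0ℤ
    re = solve-∀
    im : ∀ a b → 0ℤ * b + 0ℤ * a ≡ 0ℤ
    im = solve-∀

  ≡-isCommutativeMonoid : ∀ {_∙_ ε} → Associative _∙_ → LeftIdentity ε _∙_ → Commutative _∙_ →
                        IsCommutativeMonoid _∙_ ε
  ≡-isCommutativeMonoid {_∙_} assoc identityˡ comm = IsCommutativeMonoidˡ.isCommutativeMonoid record
    { isSemigroup = record
      { isMagma = record { isEquivalence = isEquivalence ; ∙-cong = cong₂ _∙_ }
      ; assoc   = assoc }
    ; identityˡ = identityˡ
    ; comm      = comm }

  commutativeSemiring : CommutativeSemiring _ _
  commutativeSemiring = record
    { Carrier = QZ ; _≈_ = _≡_ ; _+_ = _⊕_ ; _*_ = _⊗_ ; 0# = 0q ; 1# = 1q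
    ; isCommutativeSemiring = IsCommutativeSemiringˡ.isCommutativeSemiring record
    { +-isCommutativeMonoid = ≡-isCommutativeMonoid ⊕-assoc ⊕-identityˡ ⊕-comm
    ; *-isCommutativeMonoid = ≡-isCommutativeMonoid ⊗-assoc ⊗-identityˡ ⊗-comm
    ; distribʳ = ⊗-distribʳ-⊕
    ; zeroˡ    = ⊗-zeroˡ } }

  open CommutativeSemiring commutativeSemiring using (semiring)
  open import Algebra.Properties.Semiring.Exp semiring renaming (_^_ to _^q_) using ()
  open import Algebra.Properties.Semiring.Mult semiring renaming (_×_ to _×ₙ_) using ()
  open import Algebra.Properties.CommutativeSemiring.Exp commutativeSemiring using (^-distrib-*)
  open FreshmansDream commutativeSemiring using (freshmansDream)

  pow≡^ : ∀ x n → pow d x n ≡ x ^q n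
  pow≡^ x zero    = refl
  pow≡^ x (suc n) = cong (x ⊗_) (pow≡^ x n)

  pow-⊗ : ∀ x y n → pow d (x ⊗ y) n ≡ pow d x n ⊗ pow d y n
  pow-⊗ x y n = begin
    pow d (x ⊗ y) n           ≡⟨ pow≡^ (x ⊗ y) n ⟩
    (x ⊗ y) ^q n              ≡⟨ ^-distrib-* x y n ⟩
    x ^q n ⊗ y ^q n           ≡⟨ cong₂ _⊗_ (pow≡^ x n) (pow≡^ y n) ⟨
    pow d x n ⊗ pow d y n     ∎
    where open ≡-Reasoning

  pow-real : ∀ a n → pow d (a , 0ℤ) n ≡ (a ^ n , 0ℤ)
  pow-real a zero    = refl
  pow-real a (suc n) =
    trans (cong ((a , 0ℤ) ⊗_) (pow-real a n)) (cong₂ _,_ (re a (a ^ n) d) (im a (a ^ n)))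
    where
    re : ∀ a r d → a * r + d * (0ℤ * 0ℤ) ≡ a * r
    re = solve-∀
    im : ∀ a r → a * 0ℤ + 0ℤ * r ≡ 0ℤ
    im = solve-∀

  pow-pure-odd : ∀ b m → pow d (0ℤ , b) (suc (m ℕ.* 2)) ≡ (0ℤ , b * (d * (b * b)) ^ m)
  pow-pure-odd b zero    = cong₂ _,_ (re b d) (im b)
    where
    re : ∀ b d → 0ℤ * 1ℤ + d * (b * 0ℤ) ≡ 0ℤ
    re = solve-∀
    im : ∀ b → 0ℤ * 0ℤ + b * 1ℤ ≡ b * 1ℤ
    im = solve-∀
  pow-pure-odd b (suc m) =
    trans (cong (λ x → (0ℤ , b) ⊗ ((0ℤ , b) ⊗ x)) (pow-pure-odd b m)) (cong₂ _,_ (re b d e) (im b d e))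
    where
    e : ℤ
    e = (d * (b * b)) ^ m
    re : ∀ b d e → 0ℤ * (0ℤ * 0ℤ + d * (b * (b * e))) + d * (b * (0ℤ * (b * e) + b * 0ℤ)) ≡ 0ℤ
    re = solve-∀
    im : ∀ b d e → 0ℤ * (0ℤ * (b * e) + b * 0ℤ) + b * (0ℤ * 0ℤ + d * (b * (b * e)))
                 ≡ b * (d * (b * b) * e)
    im = solve-∀

  ×-1q : ∀ n → n ×ₙ 1q ≡ (+ n , 0ℤ)
  ×-1q zero    = refl
  ×-1q (suc n) = cong (1q ⊕_) (×-1q n)

  Im-real-⊗ : ∀ c x → Im ((c , 0ℤ) ⊗ x) ≡ c * Im x
  Im-real-⊗ c (a , b) = cancel c a b
    where
    cancel : ∀ c a b → c * b + 0ℤ * a ≡ c * b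
    cancel = solve-∀

  Im-⊗-pure : ∀ x c → Im (x ⊗ (0ℤ , c)) ≡ Re x * c
  Im-⊗-pure (a , b) c = cancel a b c
    where
    cancel : ∀ a b c → a * c + b * 0ℤ ≡ a * c
    cancel = solve-∀

  Im-pow-scale : ∀ c a b n → Im (pow d (c * a , c * b) n) ≡ c ^ n * Im (pow d (a , b) n)
  Im-pow-scale c a b n = begin
    Im (pow d (c * a , c * b) n)
      ≡⟨ cong (λ x → Im (pow d x n)) (cong₂ _,_ (re c a b d) (im c a b)) ⟩
    Im (pow d (c′ ⊗ x) n)         ≡⟨ cong Im (pow-⊗ c′ x n) ⟩
    Im (pow d c′ n ⊗ pow d x n)   ≡⟨ cong (λ y → Im (y ⊗ pow d x n)) (pow-real c n) ⟩
    Im ((c ^ n , 0ℤ) ⊗ pow d x n) ≡⟨ Im-real-⊗ (c ^ n) (pow d x n) ⟩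
    c ^ n * Im (pow d x n)        ∎
    where
    open ≡-Reasoning
    c′ x : QZ
    c′ = c , 0ℤ
    x = a , b
    re : ∀ c a b d → c * a ≡ c * a + d * (0ℤ * b)
    re = solve-∀
    im : ∀ c a b → c * b ≡ c * b + 0ℤ * a
    im = solve-∀

  Im-pow-√d-mul : ∀ a b m → let p = suc (m ℕ.* 2) in
                    Im (pow d (d * b , a) p) ≡ Re (pow d (a , b) p) * d ^ m
  Im-pow-√d-mul a b m = begin
    Im (pow d (d * b , a) p)
      ≡⟨ cong (λ x → Im (pow d x p)) (cong₂ _,_ (re a b d) (im a b)) ⟩
    Im (pow d ((a , b) ⊗ √d) p)                ≡⟨ cong Im (pow-⊗ (a , b) √d p) ⟩
    Im (x ⊗ pow d √d p)                        ≡⟨ cong (λ y → Im (x ⊗ y)) (pow-pure-odd 1ℤ m) ⟩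
    Im (x ⊗ (0ℤ , 1ℤ * (d * 1ℤ) ^ m))          ≡⟨ Im-⊗-pure x _ ⟩
    Re x * (1ℤ * (d * 1ℤ) ^ m)                 ≡⟨ cong (Re x *_) (ℤ.*-identityˡ _) ⟩
    Re x * (d * 1ℤ) ^ m                        ≡⟨ cong (λ e → Re x * e ^ m) (ℤ.*-identityʳ d) ⟩
    Re x * d ^ m                               ∎
    where
    open ≡-Reasoning
    p : ℕ
    p = suc (m ℕ.* 2)
    √d x : QZ
    √d = 0ℤ , 1ℤ
    x = pow d (a , b) p
    re : ∀ a b d → d * b ≡ a * 0ℤ + d * (b * 1ℤ)
    re = solve-∀
    im : ∀ a b → a ≡ a * 1ℤ + b * 0ℤ
    im = solve-∀

  pow-first-order : ∀ a b n → ∃₂ λ r t →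
    pow d (a , b) (suc n) ≡ (a ^ suc n + b * b * r , + suc n * a ^ n * b + b * b * b * t)
  pow-first-order a b zero = 0ℤ , 0ℤ , cong₂ _,_ (re a b d) (im a b d)
    where
    re : ∀ a b d → a * 1ℤ + d * (b * 0ℤ) ≡ a * 1ℤ + b * b * 0ℤ
    re = solve-∀
    im : ∀ a b d → a * 0ℤ + b * 1ℤ ≡ 1ℤ * 1ℤ * b + b * b * b * 0ℤ
    im = solve-∀
  pow-first-order a b (suc n) with pow-first-order a b n
  ... | r , t , eq = a * r + d * (+ suc n) * a ^ n + d * b * b * t , a * t + r ,
    trans (cong ((a , b) ⊗_) eq)
          (cong₂ _,_ (re a b d (a ^ n) (+ suc n) r t) (im a b d (a ^ n) (+ suc n) r t))
    where
    re : ∀ a b d e N r t → a * (a * e + b * b * r) + d * (b * (N * e * b + b * b * b * t))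
                         ≡ a * (a * e) + b * b * (a * r + d * N * e + d * b * b * t)
    re = solve-∀
    im : ∀ a b d e N r t → a * (N * e * b + b * b * b * t) + b * (a * e + b * b * r)
                         ≡ (1ℤ + N) * (a * e) * b + b * b * b * (a * t + r)
    im = solve-∀

  Im-pow-prime : ∀ {p m} → Prime p → p ≡ suc (m ℕ.* 2) → ∀ a b →
                 ∃[ t ] Im (pow d (a , b) p) ≡ b * (d * (b * b)) ^ m + + p * t
  Im-pow-prime {p} {m} p-prime p≡1+2m a b = Im z , (begin
    Im (pow d (a , b) p)                            ≡⟨ cong (λ x → Im (pow d x p)) split ⟩
    Im (pow d (x ⊕ y) p)                            ≡⟨ cong Im (trans (pow≡^ (x ⊕ y) p) dream) ⟩
    Im (x ^q p) + Im (y ^q p) + Im ((p ×ₙ 1q) ⊗ z)  ≡⟨ cong₂ _+_ (cong₂ _+_ Im-x^p Im-y^p) Im-pz ⟩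
    0ℤ + b * (d * (b * b)) ^ m + + p * Im z         ≡⟨ cong (_+ + p * Im z) (ℤ.+-identityˡ (b * _)) ⟩
    b * (d * (b * b)) ^ m + + p * Im z              ∎)
    where
    open ≡-Reasoning
    x y : QZ
    x = a , 0ℤ
    y = 0ℤ , b
    split : (a , b) ≡ x ⊕ y
    split = cong₂ _,_ (sym (ℤ.+-identityʳ a)) (sym (ℤ.+-identityˡ b))
    z : QZ
    z = proj₁ (freshmansDream p-prime x y)
    dream = proj₂ (freshmansDream p-prime x y)
    Im-x^p : Im (x ^q p) ≡ 0ℤ
    Im-x^p = cong Im (trans (sym (pow≡^ x p)) (pow-real a p))
    Im-y^p : Im (y ^q p) ≡ b * (d * (b * b)) ^ m
    Im-y^p = cong Im (trans (sym (pow≡^ y p)) (trans (cong (pow d y) p≡1+2m) (pow-pure-odd b m)))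
    Im-pz : Im ((p ×ₙ 1q) ⊗ z) ≡ + p * Im z
    Im-pz = trans (cong (λ c → Im (c ⊗ z)) (×-1q p)) (Im-real-⊗ (+ p) z)

module OddPrimePower (d : ℤ) (m : ℕ) (p-prime : Prime (suc (m ℕ.* 2)))
                     (p∤d : ¬ (+ suc (m ℕ.* 2) ∣ d)) where

  open ℤ[√d] d

  p : ℕ
  p = suc (m ℕ.* 2)

  Im-pow≡0⇒p∣b : ∀ a b → Im (pow d (a , b) p) ≡ 0ℤ → + p ∣ b
  Im-pow≡0⇒p∣b a b Im≡0 =
    [ id , p∣e⇒p∣b ∘ prime∣^⇒∣ p-prime (d * (b * b)) m ]′ (prime∣*⇒∣⊎∣ p-prime b _ p∣b*e^m)
    where
    frobenius = Im-pow-prime {m = m} p-prime refl a b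
    p∣b*e^m : + p ∣ b * (d * (b * b)) ^ m
    p∣b*e^m = x+kt≡0⇒k∣x (proj₁ frobenius) (trans (sym (proj₂ frobenius)) Im≡0)
    p∣e⇒p∣b : + p ∣ d * (b * b) → + p ∣ b
    p∣e⇒p∣b = [ ⊥-elim ∘ p∤d , [ id , id ]′ ∘ prime∣*⇒∣⊎∣ p-prime b b ]′
            ∘ prime∣*⇒∣⊎∣ p-prime d (b * b)

  Im-pow≡0⇒p∣a : ∀ a b → b ≢ 0ℤ → Im (pow d (a , b * + p) p) ≡ 0ℤ → + p ∣ a
  Im-pow≡0⇒p∣a a b b≢0 Im≡0 = prime∣^⇒∣ p-prime a (m ℕ.* 2) (x+kt≡0⇒k∣x (b * b * t)
    (i≢0⇒i*j≡0⇒j≡0 p≢0 (i≢0⇒i*j≡0⇒j≡0 p≢0 (i≢0⇒i*j≡0⇒j≡0 b≢0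
      (trans (sym (factor (+ p) b (a ^ (m ℕ.* 2)) t)) (trans (sym (cong Im pow≡)) Im≡0))))))
    where
    p≢0 : + p ≢ 0ℤ
    p≢0 ()
    expansion = pow-first-order a (b * + p) (m ℕ.* 2)
    t : ℤ
    t = proj₁ (proj₂ expansion)
    pow≡ = proj₂ (proj₂ expansion)
    factor : ∀ P b e t → P * e * (b * P) + b * P * (b * P) * (b * P) * t
                       ≡ b * (P * (P * (e + P * (b * b * t))))
    factor = solve-∀

  ImaginaryRoot : QZ → Set
  ImaginaryRoot (a , b) = b ≢ 0ℤ × Im (pow d (a , b) p) ≡ 0ℤ

  imaginaryRoot-descent : Descent (_<_ on (∣_∣ ∘ Im)) ImaginaryRoot
  imaginaryRoot-descent {a , b} (b≢0 , Im≡0) = (a′ , b′) , ∣b′∣<∣b∣ , b′≢0 , Im′≡0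
    where
    open _∣_ (Im-pow≡0⇒p∣b a b Im≡0) renaming (quotient to b′; equality to b≡b′p)
    b′≢0 : b′ ≢ 0ℤ
    b′≢0 = i*j≢0⇒i≢0 (b≢0 ∘ trans b≡b′p)
    open _∣_ (Im-pow≡0⇒p∣a a b′ b′≢0 (subst (λ y → Im (pow d (a , y) p) ≡ 0ℤ) b≡b′p Im≡0))
      renaming (quotient to a′; equality to a≡a′p)
    ∣b′∣<∣b∣ : ∣ b′ ∣ < ∣ b ∣
    ∣b′∣<∣b∣ = subst (∣ b′ ∣ <_) (sym (trans (cong ∣_∣ b≡b′p) (ℤ.abs-* b′ (+ p))))
      (ℕ.m<m*n ∣ b′ ∣ p {{ℤ.≢-nonZero b′≢0}} (ℕ.nonTrivial⇒n>1 p {{prime⇒nonTrivial p-prime}}))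
    Im′≡0 : Im (pow d (a′ , b′) p) ≡ 0ℤ
    Im′≡0 = i≢0⇒i*j≡0⇒j≡0 (λ p^p≡0 → contradiction (ℤ.i^n≡0⇒i≡0 (+ p) p p^p≡0) λ ())
      (trans (sym (Im-pow-scale (+ p) a′ b′ p))
        (trans (cong₂ (λ x y → Im (pow d (x , y) p))
                      (sym (trans a≡a′p (ℤ.*-comm a′ (+ p)))) (sym (trans b≡b′p (ℤ.*-comm b′ (+ p)))))
               Im≡0))

  Im-pow≡0⇔b≡0 : ∀ a b → Im (pow d (a , b) p) ≡ 0ℤ ⇔ b ≡ 0ℤ
  Im-pow≡0⇔b≡0 a b = mk⇔
    (λ Im≡0 → decidable-stable (b ℤ.≟ 0ℤ) λ b≢0 →
      descent∧wf⇒empty (λ {x} → imaginaryRoot-descent {x}) (On.wellFounded (∣_∣ ∘ Im) <-wellFounded)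
        (a , b) (b≢0 , Im≡0))
    (λ { refl → cong Im (pow-real a p) })

  Re-pow≡0⇔a≡0 : d ≢ 0ℤ → ∀ a b → Re (pow d (a , b) p) ≡ 0ℤ ⇔ a ≡ 0ℤ
  Re-pow≡0⇔a≡0 d≢0 a b = mk⇔
    (λ Re≡0 → Equivalence.to (Im-pow≡0⇔b≡0 (d * b) a) (trans twist (cong (_* d ^ m) Re≡0)))
    (λ { refl → i≢0⇒i*j≡0⇒j≡0 (d≢0 ∘ ℤ.i^n≡0⇒i≡0 d m)
                  (trans (ℤ.*-comm (d ^ m) _) (trans (sym twist) (cong Im (pow-real (d * b) p)))) })
    where
    twist : Im (pow d (d * b , a) p) ≡ Re (pow d (a , b) p) * d ^ m
    twist = Im-pow-√d-mul a b m

lemma3p8 : (d : ℤ) → SquareFree d → d ≢ 0ℤ → d ≢ 1ℤ →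
           (p : ℕ) → Prime p → p > 3 → gcd p ∣ d ∣ ≡ 1 →
           (a b : ℤ) →
           ((Im (pow d (a , b) p) ≡ 0ℤ) ⇔ (b ≡ 0ℤ)) ×
           ((Re (pow d (a , b) p) ≡ 0ℤ) ⇔ (a ≡ 0ℤ))
lemma3p8 d _ d≢0 _ p p-prime p>3 gcd[p,∣d∣]≡1 a b with odd-prime p-prime (ℕ.<-trans (ℕ.n<1+n 2) p>3)
... | m , refl = Im-pow≡0⇔b≡0 a b , Re-pow≡0⇔a≡0 d≢0 a b
  where
  p∤d : ¬ (+ suc (m ℕ.* 2) ∣ d)
  p∤d = prime∧coprime⇒∤ p-prime (gcd≡1⇒coprime gcd[p,∣d∣]≡1) ∘ ∣⇒∣ᵤ
  open OddPrimePower d m p-prime p∤d
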